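{- There exists a property (an isomorphism-closed class of finite structures over a vocabulary consisting of one binary relation symbol) that is definable by an order-invariant $\mathsf{CFO}$ sentence but is not definable by any first-order sentence.
   Context: Cluster first-order logic ($\mathsf{CFO}$) over a vocabulary with a binary relation symbol $E$ (and possibly unary symbols $P_\ell$) plus an order symbol $<$ interpreted as a linear order: fix an infinite alphabet $\Sigma$; variables $x_w^i$ ($w\in\Sigma^*$, $i\in\mathbb N$). For finite $S\subseteq\Sigma^*\times\mathbb N$, $X_S=\{x_w^i:(w,i)\in S\}$; $S$ is valid if $(w,i)\in S\Rightarrow(w,j)\in S$ for $j<i$ and $(w\alpha,0)\in S\Rightarrow(w,0)\in S$. $\mathsf{CFO}_S[0]$: Boolean combinations of $P_\ell(x_w^i)$, $E(x_w^i,x_w^j)$, $x_w^i\sim x_w^j$, $x_{w\alpha}^0\sim x_w^i$ (variables in $X_S$, $\sim\in\{=,<,>\}$). $\mathsf{CFO}_S[k+1]$: Boolean combinations of $\mathsf{CFO}_S[0]$ formulas and of $\exists x_\epsilon^0\psi$ ($S=\emptyset$, $\psi\in\mathsf{CFO}_{\{(\epsilon,0)\}}[k]$), $\exists x^0_{w\alpha}\psi$ ($(w,0)\in S$, $(w\alpha,0)\notin S$, $\psi\in\mathsf{CFO}_{S\cup\{(w\alpha,0)\}}[k]$), $\exists x_w^i(E(x_w^i,x_w^j)\wedge\psi)$ ($(w,j)\in S$, $i$ least with $(w,i)\notin S$, $\psi\in\mathsf{CFO}_{S\cup\{(w,i)\}}[k]$). $\mathsf{CFO}=\bigcup_k\mathsf{CFO}_\emptyset[k]$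 with usual first-order semantics. A $\mathsf{CFO}$ sentence is order-invariant if, on every finite structure, its truth value does not depend on which linear order interprets $<$. -}

module Defs where

open import Data.Nat using (ℕ; zero; suc) renaming (_<_ to _<ℕ_; _≟_ to _≟ℕ_)
open import Data.Fin using (Fin)
open import Data.Bool using (Bool; true; false; if_then_else_)
open import Data.List using (List; []; _∷_; [_]; _++_)
import Data.List.Properties as LP
import Data.Product.Properties as PP
open import Data.List.Membership.Propositional using (_∈_; _∉_)
open import Data.Maybe using (Maybe; just; nothing)
open import Data.Product using (Σ; ∃; _×_; _,_)
open import Data.Empty using (⊥)
open import Data.Unit using (⊤)
open import Relation.Nullary using (¬_; does)
open import Relation.Binary.PropositionalEquality using (_≡_)
open import Relation.Binary.Definitions using (DecidableEquality)
open import Relation.Binary.Structures using (IsStrictTotalOrder)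
open import Function.Bundles using (_↔_; _⇔_; Inverse)

record Str : Set where
  field
    size : ℕ
    E    : Fin size → Fin size → Bool
open Str public

_≅_ : Str → Str → Set
A ≅ B = Σ (Fin (size A) ↔ Fin (size B)) λ f →
          ∀ a b → E A a b ≡ E B (Inverse.to f a) (Inverse.to f b)

Property : Set₁
Property = Str → Set

IsoClosed : Property → Set
IsoClosed P = ∀ A B → A ≅ B → P A → P B

record LinOrd (n : ℕ) : Set₁ where
  field
    _≺_   : Fin n → Fin n → Set
    isSTO : IsStrictTotalOrder _≡_ _≺_
open LinOrd public

-- Variables x_w^i with alphabet Σ = ℕ (an infinite alphabet),
-- w ∈ Σ*, i ∈ ℕ.  Represented by the pair (w , i).

Var : Set
Var = List ℕ × ℕ

_≟V_ : DecidableEquality Var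
_≟V_ = PP.≡-dec (LP.≡-dec _≟ℕ_) _≟ℕ_

data Cmp : Set where
  eqC ltC gtC : Cmp

data Fm : Set where
  tt   : Fm
  Eₐ   : Var → Var → Fm
  cmp  : Cmp → Var → Var → Fm
  neg  : Fm → Fm
  and  : Fm → Fm → Fm
  ex   : Var → Fm → Fm

Env : ℕ → Set
Env n = Var → Maybe (Fin n)

emptyEnv : ∀ {n} → Env n
emptyEnv _ = nothing

update : ∀ {n} → Env n → Var → Fin n → Env n
update ρ x a y = if does (y ≟V x) then just a else ρ y

lift2 : ∀ {n} → (Fin n → Fin n → Set) → Maybe (Fin n) → Maybe (Fin n) → Set
lift2 R (just a) (just b) = R a b
lift2 R _        _        = ⊥

cmpRel : ∀ {n} → (Fin n → Fin n → Set) → Cmp → Fin n → Fin n → Set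
cmpRel lt eqC a b = a ≡ b
cmpRel lt ltC a b = lt a b
cmpRel lt gtC a b = lt b a

Sat : (A : Str) → (Fin (size A) → Fin (size A) → Set) → Env (size A) → Fm → Set
Sat A lt ρ tt          = ⊤
Sat A lt ρ (Eₐ x y)    = lift2 (λ a b → E A a b ≡ true) (ρ x) (ρ y)
Sat A lt ρ (cmp c x y) = lift2 (cmpRel lt c) (ρ x) (ρ y)
Sat A lt ρ (neg φ)     = ¬ Sat A lt ρ φ
Sat A lt ρ (and φ ψ)   = Sat A lt ρ φ × Sat A lt ρ ψ
Sat A lt ρ (ex x φ)    = ∃ λ a → Sat A lt (update ρ x a) φ

_,_⊨<_ : (A : Str) → LinOrd (size A) → Fm → Set
A , o ⊨< φ = Sat A (_≺_ o) emptyEnv φ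

-- Plain structure satisfies an order-free sentence (the interpretation
-- of < is irrelevant for FO sentences, which contain no < atoms)
_⊨_ : Str → Fm → Set
A ⊨ φ = Sat A (λ _ _ → ⊥) emptyEnv φ

data FO (S : List Var) : Fm → Set where
  fo-tt  : FO S tt
  fo-E   : ∀ {x y} → x ∈ S → y ∈ S → FO S (Eₐ x y)
  fo-eq  : ∀ {x y} → x ∈ S → y ∈ S → FO S (cmp eqC x y)
  fo-neg : ∀ {φ} → FO S φ → FO S (neg φ)
  fo-and : ∀ {φ ψ} → FO S φ → FO S ψ → FO S (and φ ψ)
  fo-ex  : ∀ {x φ} → FO (x ∷ S) φ → FO S (ex x φ)

FOSentence : Fm → Set
FOSentence = FO []

-- Cluster first-order logic: CFO S k φ  means  φ ∈ CFO_S[k].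
-- x_{wα} is the variable with word w ++ [ α ].

data CFO (S : List Var) : ℕ → Fm → Set where
  c-tt   : ∀ {k} → CFO S k tt
  c-E    : ∀ {k w i j} → (w , i) ∈ S → (w , j) ∈ S →
           CFO S k (Eₐ (w , i) (w , j))
  c-cmp  : ∀ {k w i j} c → (w , i) ∈ S → (w , j) ∈ S →
           CFO S k (cmp c (w , i) (w , j))
  c-cmpc : ∀ {k w α i} c → (w ++ [ α ] , 0) ∈ S → (w , i) ∈ S →
           CFO S k (cmp c (w ++ [ α ] , 0) (w , i))
  c-neg  : ∀ {k φ} → CFO S k φ → CFO S k (neg φ)
  c-and  : ∀ {k φ ψ} → CFO S k φ → CFO S k ψ → CFO S k (and φ ψ)
  c-ex-root  : ∀ {k ψ} → S ≡ [] → CFO ((([] , 0)) ∷ S) k ψ →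
               CFO S (suc k) (ex ([] , 0) ψ)
  c-ex-child : ∀ {k w α ψ} → (w , 0) ∈ S → (w ++ [ α ] , 0) ∉ S →
               CFO ((w ++ [ α ] , 0) ∷ S) k ψ →
               CFO S (suc k) (ex (w ++ [ α ] , 0) ψ)
  c-ex-nbr   : ∀ {k w i j ψ} → (w , j) ∈ S → (w , i) ∉ S →
               (∀ i' → i' <ℕ i → (w , i') ∈ S) →
               CFO ((w , i) ∷ S) k ψ →
               CFO S (suc k) (ex (w , i) (and (Eₐ (w , i) (w , j)) ψ))

CFOSentence : Fm → Set
CFOSentence φ = ∃ λ k → CFO [] k φ

OrderInvariant : Fm → Set₁
OrderInvariant φ = ∀ (A : Str) (o₁ o₂ : LinOrd (size A)) →
                   (A , o₁ ⊨< φ) ⇔ (A , o₂ ⊨< φ)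

DefinesOrd : Fm → Property → Set₁
DefinesOrd φ P = ∀ (A : Str) (o : LinOrd (size A)) → P A ⇔ (A , o ⊨< φ)

Defines : Fm → Property → Set
Defines φ P = ∀ (A : Str) → P A ⇔ (A ⊨ φ)

module Submission where

-- The property EvenAtoms: E has a top element r (E(a, r) for all a), the atoms of E (elements
-- with a proper E-predecessor, all of whose proper E-predecessors are E-bottoms) are rich (some
-- element is E-above no atom, and any element can be extended by any single atom), and the
-- number of atoms is positive and even.
--
-- Given a linear order, richness yields an element lying E-above exactly the atoms of even rank;
-- conversely, an element lying above the least atom but not the greatest one, and alternating
-- between consecutive atoms, forces the number of atoms to be even. So the order defines the
-- property without influencing its truth value. As the top is E-related to every element, all
-- quantifiers can be relativised to E-predecessors of the top, i.e. to CFO neighbour quantifiers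
-- of the root cluster.
--
-- On the powerset algebra Pow n the property says that n is positive and even. The profile of a
-- point c with respect to a tuple of subsets records which of them contain c. Tuples in which each
-- profile occurs equally often, or at least 2^q times on both sides, satisfy the same FO formulas
-- of quantifier rank q (an Ehrenfeucht–Fraïssé argument), so no FO sentence separates
-- Pow (2 · 2^q) from Pow (2 · 2^q + 1).

open import Defs
open import Data.Bool.Base using (Bool; true; false; T; _∨_; if_then_else_)
import Data.Bool.Properties as Bool
open import Data.Bool.Properties using (T-≡; T-∨; T?)
open import Data.Empty using (⊥; ⊥-elim)
open import Data.Fin using (Fin; zero; suc; #_; _↑ˡ_; _↑ʳ_; splitAt) renaming (_<_ to _<ᶠ_)
open import Data.Fin.Properties
  using (any?; all?; ∀-cons; suc-injective; <-isStrictTotalOrder; splitAt-↑ˡ; splitAt-↑ʳ; splitAt⁻¹-↑ˡ; splitAt⁻¹-↑ʳ)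
  renaming (_≟_ to _≟ᶠ_)
open import Data.List.Base using (List; []; _∷_; allFin; length)
open import Data.List.Membership.Propositional using (_∈_; _∉_)
open import Data.List.Membership.Propositional.Properties using (∈-allFin)
open import Data.List.Relation.Unary.All as All using (All; []; _∷_)
open import Data.List.Relation.Unary.Any as Any using (Any; here; there)
open import Data.Maybe.Base using (just; nothing) renaming (map to mapᵐ)
open import Data.Nat.Base using (ℕ; zero; suc; _+_; _∸_; _≤_; _<_; _⊔_; z≤n; s≤s; s≤s⁻¹; parity)
import Data.Nat.Properties as ℕ
open import Data.Nat.Properties
  using (_≤?_; ≤-refl; ≤-trans; +-suc; +-comm; +-mono-≤; +-cancelˡ-≤; +-cancelˡ-≡; m≤m+n; m≤n+m; n≤1+n; ≰⇒>; <⇒≤;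
         <⇒≢; m≤n⇒m<n∨m≡n; m+n≤o⇒m≤o∸n; m+[n∸m]≡n; n≤0⇒n≡0; m⊔n≤o⇒m≤o; m⊔n≤o⇒n≤o; m+n≡0⇒m≡0)
open import Data.Parity.Base using (0ℙ; 1ℙ; _⁻¹)
open import Data.Parity.Properties
  using (suc-homo-⁻¹; ⁻¹-selfInverse; +-homo-+; p+p≡0ℙ) renaming (_≟_ to _≟ℙ_)
open import Data.Product.Base using (Σ; ∃; ∃₂; _×_; _,_; proj₁; proj₂; map₂; uncurry)
open import Data.Product.Function.Dependent.Propositional using (Σ-⇔)
open import Data.Product.Function.NonDependent.Propositional using (_×-⇔_)
open import Data.Sum.Base using (_⊎_; inj₁; inj₂; [_,_])
open import Data.Sum.Function.Propositional using (_⊎-⇔_)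
open import Data.Vec.Base using (Vec; []; _∷_; lookup; map)
open import Data.Vec.Functional using () renaming (_∷_ to _∷ᵥ_)
open import Data.Vec.Properties using (lookup-map; ∷-injective) renaming (≡-dec to ≡-decᵥ)
open import Function.Base using (_∘_; id)
open import Function.Bundles using (_⇔_; mk⇔; Equivalence; Inverse; Injection)
open import Function.Definitions using (Injective)
open import Function.Properties.Equivalence
  using () renaming (refl to ⇔-refl; sym to ⇔-sym; trans to ⇔-trans)
open import Function.Properties.Inverse using (↔⇒↠; ↔⇒↣)
import Function.Related.Propositional as Related
open import Function.Related.TypeIsomorphisms using (¬-cong-⇔)
open import Level using (0ℓ)
import Relation.Binary.Construct.Flip.EqAndOrd as Flip
open import Relation.Binary.Core using (Rel)
open import Relation.Binary.Definitions
  using (DecidableEquality; tri<; tri≈; tri>) renaming (Decidable to Decidable₂)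
import Relation.Binary.Morphism.OrderMonomorphism as OrderMonomorphism
open import Relation.Binary.Morphism.Structures using (IsOrderMonomorphism)
open import Relation.Binary.PropositionalEquality
  using (_≡_; _≢_; _≗_; refl; sym; trans; cong; cong₂; subst; subst₂)
open import Relation.Binary.Structures using (IsStrictTotalOrder)
import Relation.Nullary.Decidable as Dec
open import Relation.Nullary.Decidable
  using (Dec; yes; no; does; _×-dec_; _⊎-dec_; _→-dec_; ¬?; decidable-stable)
open import Relation.Nullary.Negation using (¬_; contradiction)
open import Relation.Unary using (Pred; Decidable)

open Equivalence using (to; from)

count : ∀ {n} {P : Pred (Fin n) 0ℓ} → Decidable P → ℕ
count {zero}  P? = 0
count {suc n} P? = if does (P? zero) then suc (count (P? ∘ suc)) else count (P? ∘ suc)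

count≡0⇔none : ∀ {n} {P : Pred (Fin n) 0ℓ} (P? : Decidable P) → count P? ≡ 0 ⇔ (∀ i → ¬ P i)
count≡0⇔none {zero}  P? = mk⇔ (λ _ ()) (λ _ → refl)
count≡0⇔none {suc n} P? with P? zero
... | yes p = mk⇔ (λ ()) (λ none → contradiction p (none zero))
... | no ¬p = ⇔-trans (count≡0⇔none (P? ∘ suc)) (mk⇔ (∀-cons ¬p) (_∘ suc))

count≢0⇒witness : ∀ {n} {P : Pred (Fin n) 0ℓ} (P? : Decidable P) → count P? ≢ 0 → ∃ P
count≢0⇒witness P? count≢0 with any? P?
... | yes witness = witness
... | no ¬witness = contradiction (from (count≡0⇔none P?) (λ i p → ¬witness (i , p))) count≢0

count-cong : ∀ {n} {P Q : Pred (Fin n) 0ℓ} (P? : Decidable P) (Q? : Decidable Q) →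
             (∀ i → P i ⇔ Q i) → count P? ≡ count Q?
count-cong {zero}  P? Q? P⇔Q = refl
count-cong {suc n} P? Q? P⇔Q with P? zero | Q? zero
... | yes _ | yes _ = cong suc (count-cong (P? ∘ suc) (Q? ∘ suc) (P⇔Q ∘ suc))
... | no _  | no _  = count-cong (P? ∘ suc) (Q? ∘ suc) (P⇔Q ∘ suc)
... | yes p | no ¬q = contradiction (to (P⇔Q zero) p) ¬q
... | no ¬p | yes q = contradiction (from (P⇔Q zero) q) ¬p

count-insert : ∀ {n} {P Q : Pred (Fin n) 0ℓ} (P? : Decidable P) (Q? : Decidable Q) {x} →
               ¬ P x → Q x → (∀ y → y ≢ x → P y ⇔ Q y) → count Q? ≡ suc (count P?)
count-insert {suc n} P? Q? {zero} ¬px qx P⇔Q with P? zero | Q? zero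
... | no _  | yes _ = cong suc (count-cong (Q? ∘ suc) (P? ∘ suc) (λ y → ⇔-sym (P⇔Q (suc y) λ ())))
... | yes p | _     = contradiction p ¬px
... | _     | no ¬q = contradiction qx ¬q
count-insert {suc n} P? Q? {suc x} ¬px qx P⇔Q with P? zero | Q? zero
... | yes _ | yes _ = cong suc (count-insert (P? ∘ suc) (Q? ∘ suc) ¬px qx (λ y → P⇔Q (suc y) ∘ (_∘ suc-injective)))
... | no _  | no _  =          count-insert (P? ∘ suc) (Q? ∘ suc) ¬px qx (λ y → P⇔Q (suc y) ∘ (_∘ suc-injective))
... | yes p | no ¬q = contradiction (to (P⇔Q zero λ ()) p) ¬q
... | no ¬p | yes q = contradiction (from (P⇔Q zero λ ()) q) ¬p

count-all : ∀ {n} {P : Pred (Fin n) 0ℓ} (P? : Decidable P) → (∀ i → P i) → count P? ≡ n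
count-all {zero}  P? all = refl
count-all {suc n} P? all with P? zero
... | yes _ = cong suc (count-all (P? ∘ suc) (all ∘ suc))
... | no ¬p = contradiction (all zero) ¬p

count-partition : ∀ {n} {P B : Pred (Fin n) 0ℓ} (P? : Decidable P) (B? : Decidable B) →
                  count (λ i → P? i ×-dec B? i) + count (λ i → P? i ×-dec ¬? (B? i)) ≡ count P?
count-partition {zero}  P? B? = refl
count-partition {suc n} P? B? with P? zero | B? zero
... | yes _ | yes _ = cong suc (count-partition (P? ∘ suc) (B? ∘ suc))
... | yes _ | no _  = trans (+-suc _ _) (cong suc (count-partition (P? ∘ suc) (B? ∘ suc)))
... | no _  | _     = count-partition (P? ∘ suc) (B? ∘ suc)

count-image : ∀ {m N} {g : Fin m → Fin N} → Injective _≡_ _≡_ g →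
              count (λ x → any? (λ c → x ≟ᶠ g c)) ≡ m
count-image {zero}  {g = g} g-injective =
  from (count≡0⇔none (λ x → any? (λ c → x ≟ᶠ g c))) (λ { _ (() , _) })
count-image {suc m} {g = g} g-injective =
  trans (count-insert (λ x → any? (λ c → x ≟ᶠ g (suc c))) (λ x → any? (λ c → x ≟ᶠ g c))
                      (λ (c , g0≡gc) → contradiction (g-injective g0≡gc) λ ()) (zero , refl) same)
        (cong suc (count-image (suc-injective ∘ g-injective)))
  where
  same : ∀ y → y ≢ g zero → (∃ λ c → y ≡ g (suc c)) ⇔ (∃ λ c → y ≡ g c)
  same y y≢g0 = mk⇔ (λ (c , eq) → suc c , eq)
                    (λ { (zero , eq) → contradiction eq y≢g0 ; (suc c , eq) → c , eq })

module _ {N : ℕ} {_<_ : Rel (Fin N) 0ℓ} (sto : IsStrictTotalOrder _≡_ _<_)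
         {P : Pred (Fin N) 0ℓ} (P? : Decidable P) where
  open IsStrictTotalOrder sto using (compare; irrefl) renaming (trans to <-trans)

  private
    MaximumOf : List (Fin N) → Set
    MaximumOf xs = ∃ λ m → P m × All (λ z → P z → ¬ m < z) xs

    maximum-∷ : ∀ {xs} x → P x → MaximumOf xs → MaximumOf (x ∷ xs)
    maximum-∷ x px (m , pm , m-max) with compare m x
    ... | tri< m<x _ _ =
      x , px , (λ _ → irrefl refl) ∷ All.map (λ m≮z pz x<z → m≮z pz (<-trans m<x x<z)) m-max
    ... | tri≈ m≮x _ _ = m , pm , (λ _ → m≮x) ∷ m-max
    ... | tri> m≮x _ _ = m , pm , (λ _ → m≮x) ∷ m-max

    maximum-of : ∀ xs → Any P xs → MaximumOf xs
    maximum-of (x ∷ xs) (here px) with Any.any? P? xs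
    ... | yes any = maximum-∷ x px (maximum-of xs any)
    ... | no ¬any =
      x , px , (λ _ → irrefl refl) ∷ All.tabulate (λ z∈xs pz _ → ¬any (Any.map (λ { refl → pz }) z∈xs))
    maximum-of (x ∷ xs) (there any) with P? x
    ... | yes px = maximum-∷ x px (maximum-of xs any)
    ... | no ¬px = let m , pm , m-max = maximum-of xs any in m , pm , (λ px → contradiction px ¬px) ∷ m-max

  maximum : ∃ P → ∃ λ m → P m × ∀ z → P z → ¬ m < z
  maximum (x , px) =
    let m , pm , m-max = maximum-of (allFin N) (Any.map (λ { refl → px }) (∈-allFin x))
    in m , pm , λ z → All.lookup m-max (∈-allFin z)

minimum : ∀ {N} {_<_ : Rel (Fin N) 0ℓ} → IsStrictTotalOrder _≡_ _<_ →
          {P : Pred (Fin N) 0ℓ} → Decidable P → ∃ P → ∃ λ m → P m × ∀ z → P z → ¬ z < m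
minimum sto = maximum (Flip.isStrictTotalOrder sto)

parity-suc : ∀ k → parity (suc k) ≡ parity k ⁻¹
parity-suc k = sym (⁻¹-selfInverse (suc-homo-⁻¹ k))

even-suc⇔odd : ∀ k → parity (suc k) ≡ 0ℙ ⇔ parity k ≢ 0ℙ
even-suc⇔odd k rewrite parity-suc k with parity k
... | 0ℙ = mk⇔ (λ ()) (λ 0ℙ≢0ℙ → contradiction refl 0ℙ≢0ℙ)
... | 1ℙ = mk⇔ (λ _ ()) (λ _ → refl)

odd-suc⇔even : ∀ k → parity (suc k) ≢ 0ℙ ⇔ parity k ≡ 0ℙ
odd-suc⇔even k rewrite parity-suc k with parity k
... | 0ℙ = mk⇔ (λ _ → refl) (λ _ ())
... | 1ℙ = mk⇔ (λ 0ℙ≢0ℙ → contradiction refl 0ℙ≢0ℙ) (λ ())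

module PointSets {N : ℕ} {Pt : Pred (Fin N) 0ℓ} (Pt? : Decidable Pt)
                 {_⊑_ : Rel (Fin N) 0ℓ} (_⊑?_ : Decidable₂ _⊑_) where

  Rich : Set
  Rich = (∃ λ T → ∀ q → Pt q → ¬ q ⊑ T)
       × (∀ T p → Pt p → ∃ λ T′ → ∀ q → Pt q → (q ⊑ T′ ⇔ (q ⊑ T ⊎ q ≡ p)))

  rich⇒realises : Rich → {D : Pred (Fin N) 0ℓ} → Decidable D →
                  ∃ λ T → ∀ q → Pt q → (q ⊑ T ⇔ D q)
  rich⇒realises (empty , insert) {D} D? =
    let T , T-ok = realise (allFin N)
    in T , λ q pq → ⇔-trans (T-ok q pq) (mk⇔ proj₁ (_, ∈-allFin q))
    where
    realise : ∀ xs → ∃ λ T → ∀ q → Pt q → (q ⊑ T ⇔ (D q × q ∈ xs))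
    realise [] = let T , none = empty in T , λ q pq → mk⇔ (λ q⊑T → contradiction q⊑T (none q pq)) (λ ())
    realise (x ∷ xs) with realise xs | D? x ×-dec Pt? x
    ... | T , T-ok | yes (dx , px) =
      let T′ , T′-ok = insert T x px
      in T′ , λ q pq → ⇔-trans (T′-ok q pq) (mk⇔
           (λ { (inj₁ q⊑T) → map₂ there (to (T-ok q pq) q⊑T) ; (inj₂ refl) → dx , here refl })
           (λ { (_ , here refl) → inj₂ refl ; (dq , there q∈xs) → inj₁ (from (T-ok q pq) (dq , q∈xs)) }))
    ... | T , T-ok | no ¬dpx =
      T , λ q pq → ⇔-trans (T-ok q pq) (mk⇔
           (map₂ there)
           (λ { (dq , here refl) → contradiction (dq , pq) ¬dpx ; (dq , there q∈xs) → dq , q∈xs }))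

  module Ordered {_<_ : Rel (Fin N) 0ℓ} (sto : IsStrictTotalOrder _≡_ _<_) where
    open IsStrictTotalOrder sto using (compare; irrefl; _<?_) renaming (trans to <-trans)

    IsLeast IsGreatest : Pred (Fin N) 0ℓ
    IsLeast p = Pt p × (∀ q → Pt q → ¬ q < p)
    IsGreatest p = Pt p × (∀ q → Pt q → ¬ p < q)

    _⋖_ : Rel (Fin N) 0ℓ
    p ⋖ q = p < q × (∀ z → Pt z → ¬ (p < z × z < q))

    Alternates : Pred (Fin N) 0ℓ
    Alternates T = (∃ λ p → IsLeast p × p ⊑ T)
                 × (∀ p q → Pt p → Pt q → p ⋖ q → (p ⊑ T ⇔ (¬ q ⊑ T)))
                 × (∃ λ p → IsGreatest p × ¬ p ⊑ T)

    rank : Fin N → ℕ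
    rank p = count (λ z → Pt? z ×-dec z <? p)

    rank≡0⇔least : ∀ {p} → Pt p → rank p ≡ 0 ⇔ IsLeast p
    rank≡0⇔least {p} pp = ⇔-trans (count≡0⇔none (λ z → Pt? z ×-dec z <? p))
      (mk⇔ (λ none → pp , λ q pq q<p → none q (pq , q<p)) (λ (_ , p-least) q (pq , q<p) → p-least q pq q<p))

    least-unique : ∀ {p p′} → IsLeast p → IsLeast p′ → p ≡ p′
    least-unique {p} {p′} (pp , p-least) (pp′ , p′-least) with compare p p′
    ... | tri< p<p′ _ _ = contradiction p<p′ (p′-least _ pp)
    ... | tri≈ _ p≡p′ _ = p≡p′
    ... | tri> _ _ p′<p = contradiction p′<p (p-least _ pp′)

    ≢⇒<⊎> : ∀ {y p} → y ≢ p → y < p ⊎ p < y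
    ≢⇒<⊎> {y} {p} y≢p with compare y p
    ... | tri< y<p _ _ = inj₁ y<p
    ... | tri≈ _ y≡p _ = contradiction y≡p y≢p
    ... | tri> _ _ p<y = inj₂ p<y

    rank-cover : ∀ {p q} → p ⋖ q → Pt p → rank q ≡ suc (rank p)
    rank-cover {p} {q} (p<q , nothing-between) pp =
      count-insert (λ z → Pt? z ×-dec z <? p) (λ z → Pt? z ×-dec z <? q)
                   (λ (_ , p<p) → irrefl refl p<p) (pp , p<q) same
      where
      same : ∀ y → y ≢ p → (Pt y × y < p) ⇔ (Pt y × y < q)
      same y y≢p = mk⇔ (map₂ (λ y<p → <-trans y<p p<q))
        (λ (py , y<q) → py , [ id , (λ p<y → contradiction (p<y , y<q) (nothing-between y py)) ] (≢⇒<⊎> y≢p))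

    rank-greatest : ∀ {p} → IsGreatest p → count Pt? ≡ suc (rank p)
    rank-greatest {p} (pp , p-greatest) =
      count-insert (λ z → Pt? z ×-dec z <? p) Pt? (λ (_ , p<p) → irrefl refl p<p) pp same
      where
      same : ∀ y → y ≢ p → (Pt y × y < p) ⇔ Pt y
      same y y≢p = mk⇔ proj₁ (λ py → py , [ id , (λ p<y → contradiction p<y (p-greatest y py)) ] (≢⇒<⊎> y≢p))

    predecessor : ∀ {q} → rank q ≢ 0 → ∃ λ p → Pt p × p ⋖ q
    predecessor {q} rank≢0 =
      let p , (pp , p<q) , p-max = maximum sto (λ z → Pt? z ×-dec z <? q) (count≢0⇒witness _ rank≢0)
      in p , pp , p<q , λ z pz (p<z , z<q) → p-max z (pz , z<q) p<z

    alternates⇒parity : ∀ {T} → Alternates T → ∀ k {p} → Pt p → rank p ≡ k → (p ⊑ T ⇔ parity k ≡ 0ℙ)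
    alternates⇒parity ((p₀ , p₀-least , p₀⊑T) , _) zero pp rank≡0
      with least-unique (to (rank≡0⇔least pp) rank≡0) p₀-least
    ... | refl = mk⇔ (λ _ → refl) (λ _ → p₀⊑T)
    alternates⇒parity {T} alt@(_ , alternating , _) (suc k) {p} pp rank≡1+k =
      let z , pz , z⋖p = predecessor (λ rank≡0 → contradiction (trans (sym rank≡1+k) rank≡0) λ ())
          z-ok = alternates⇒parity alt k pz (ℕ.suc-injective (trans (sym (rank-cover z⋖p pz)) rank≡1+k))
          z⇔¬p = alternating z p pz pp z⋖p
      in mk⇔ (λ p⊑T → from (even-suc⇔odd k) (λ even-k → to z⇔¬p (from z-ok even-k) p⊑T))
             (λ even-1+k → decidable-stable (p ⊑? T)
                 (λ ¬p⊑T → to (even-suc⇔odd k) even-1+k (to z-ok (from z⇔¬p ¬p⊑T))))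

    alternates⇒even : ∃ Alternates → count Pt? ≢ 0 × parity (count Pt?) ≡ 0ℙ
    alternates⇒even (T , alt@(_ , _ , g , (pg , g-greatest) , g⋢T)) rewrite rank-greatest (pg , g-greatest) =
      (λ ()) , from (even-suc⇔odd (rank g)) (g⋢T ∘ from (alternates⇒parity alt (rank g) pg refl))

    even⇒alternates : Rich → count Pt? ≢ 0 × parity (count Pt?) ≡ 0ℙ → ∃ Alternates
    even⇒alternates rich (count≢0 , even) = T₀ , least-in , alternating , greatest-out
      where
      some-point : ∃ Pt
      some-point = count≢0⇒witness Pt? count≢0

      even-ranked : ∃ λ T → ∀ q → Pt q → (q ⊑ T ⇔ parity (rank q) ≡ 0ℙ)
      even-ranked = rich⇒realises rich (λ q → parity (rank q) ≟ℙ 0ℙ)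

      T₀ : Fin N
      T₀ = proj₁ even-ranked

      T₀-ok : ∀ q → Pt q → (q ⊑ T₀ ⇔ parity (rank q) ≡ 0ℙ)
      T₀-ok = proj₂ even-ranked

      least-in : ∃ λ p → IsLeast p × p ⊑ T₀
      least-in = let p₀ , p₀-least = minimum sto Pt? some-point; pp₀ = proj₁ p₀-least
                 in p₀ , p₀-least , from (T₀-ok p₀ pp₀) (cong parity (from (rank≡0⇔least pp₀) p₀-least))

      alternating : ∀ p q → Pt p → Pt q → p ⋖ q → (p ⊑ T₀ ⇔ (¬ q ⊑ T₀))
      alternating p q pp pq p⋖q = begin
        p ⊑ T₀                      ∼⟨ T₀-ok p pp ⟩
        parity (rank p) ≡ 0ℙ        ∼⟨ ⇔-sym (odd-suc⇔even (rank p)) ⟩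
        parity (suc (rank p)) ≢ 0ℙ  ≡⟨ cong (λ r → parity r ≢ 0ℙ) (sym (rank-cover p⋖q pp)) ⟩
        parity (rank q) ≢ 0ℙ        ∼⟨ ¬-cong-⇔ (⇔-sym (T₀-ok q pq)) ⟩
        (¬ q ⊑ T₀)                  ∎
        where open Related.EquationalReasoning

      greatest-out : ∃ λ p → IsGreatest p × ¬ p ⊑ T₀
      greatest-out =
        let g , g-greatest = maximum sto Pt? some-point
            even-1+rank = subst (λ c → parity c ≡ 0ℙ) (rank-greatest g-greatest) even
        in g , g-greatest , to (even-suc⇔odd (rank g)) even-1+rank ∘ to (T₀-ok g (proj₁ g-greatest))

    alternates⇔even : Rich → (∃ Alternates ⇔ (count Pt? ≢ 0 × parity (count Pt?) ≡ 0ℙ))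
    alternates⇔even rich = mk⇔ alternates⇒even (even⇒alternates rich)

-- Guarded formulas and their translation into CFO

infixr 7 ¬ᶠ_
infixr 6 _∧ᶠ_
infixr 5 _∨ᶠ_
infix  4 _⇔ᶠ_
infixr 3 _⇒ᶠ_

data Formula : ℕ → Set where
  edge less equal : ∀ {d} → Fin d → Fin d → Formula d
  ¬ᶠ_ : ∀ {d} → Formula d → Formula d
  _∧ᶠ_ _∨ᶠ_ _⇒ᶠ_ _⇔ᶠ_ : ∀ {d} → Formula d → Formula d → Formula d
  ∃ᶠ ∀ᶠ : ∀ {d} → Formula (suc d) → Formula d

depth : ∀ {d} → Formula d → ℕ
depth (edge _ _)  = 0
depth (less _ _)  = 0
depth (equal _ _) = 0
depth (¬ᶠ f)      = depth f
depth (f ∧ᶠ g)    = depth f ⊔ depth g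
depth (f ∨ᶠ g)    = depth f ⊔ depth g
depth (f ⇒ᶠ g)    = depth f ⊔ depth g
depth (f ⇔ᶠ g)    = depth f ⊔ depth g
depth (∃ᶠ f)      = suc (depth f)
depth (∀ᶠ f)      = suc (depth f)

implications⇔equivalence : ∀ {X Y : Set} → ((X → Y) × (Y → X)) ⇔ (X ⇔ Y)
implications⇔equivalence = mk⇔ (uncurry mk⇔) (λ X⇔Y → to X⇔Y , from X⇔Y)

module Semantics (A : Str) (_<_ : Rel (Fin (size A)) 0ℓ) where

  ⟦_⟧ : ∀ {d} → Formula d → (Fin d → Fin (size A)) → Set
  ⟦ edge i j ⟧  γ = E A (γ i) (γ j) ≡ true
  ⟦ less i j ⟧  γ = γ i < γ j
  ⟦ equal i j ⟧ γ = γ i ≡ γ j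
  ⟦ ¬ᶠ f ⟧      γ = ¬ ⟦ f ⟧ γ
  ⟦ f ∧ᶠ g ⟧    γ = ⟦ f ⟧ γ × ⟦ g ⟧ γ
  ⟦ f ∨ᶠ g ⟧    γ = ⟦ f ⟧ γ ⊎ ⟦ g ⟧ γ
  ⟦ f ⇒ᶠ g ⟧    γ = ⟦ f ⟧ γ → ⟦ g ⟧ γ
  ⟦ f ⇔ᶠ g ⟧    γ = ⟦ f ⟧ γ ⇔ ⟦ g ⟧ γ
  ⟦ ∃ᶠ f ⟧      γ = ∃ λ a → ⟦ f ⟧ (a ∷ᵥ γ)
  ⟦ ∀ᶠ f ⟧      γ = ∀ a → ⟦ f ⟧ (a ∷ᵥ γ)

  module Decide (_<?_ : Decidable₂ _<_) where

    ⟦_⟧? : ∀ {d} (f : Formula d) γ → Dec (⟦ f ⟧ γ)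
    ⟦ edge i j ⟧?  γ = E A (γ i) (γ j) Bool.≟ true
    ⟦ less i j ⟧?  γ = γ i <? γ j
    ⟦ equal i j ⟧? γ = γ i ≟ᶠ γ j
    ⟦ ¬ᶠ f ⟧?      γ = ¬? (⟦ f ⟧? γ)
    ⟦ f ∧ᶠ g ⟧?    γ = ⟦ f ⟧? γ ×-dec ⟦ g ⟧? γ
    ⟦ f ∨ᶠ g ⟧?    γ = ⟦ f ⟧? γ ⊎-dec ⟦ g ⟧? γ
    ⟦ f ⇒ᶠ g ⟧?    γ = ⟦ f ⟧? γ →-dec ⟦ g ⟧? γ
    ⟦ f ⇔ᶠ g ⟧?    γ = Dec.map implications⇔equivalence
                              ((⟦ f ⟧? γ →-dec ⟦ g ⟧? γ) ×-dec (⟦ g ⟧? γ →-dec ⟦ f ⟧? γ))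
    ⟦ ∃ᶠ f ⟧?      γ = any? (λ a → ⟦ f ⟧? (a ∷ᵥ γ))
    ⟦ ∀ᶠ f ⟧?      γ = all? (λ a → ⟦ f ⟧? (a ∷ᵥ γ))

root : Var
root = [] , 0

neighbour : ℕ → Var
neighbour k = [] , k

-- The variable with de Bruijn index i is x_ε^(level i); the root x_ε^0 is not indexed, and
-- every quantifier becomes a CFO neighbour quantifier guarded by E(x, x_ε^0), which ⟦_⟧ drops.

level : ∀ {d} → Fin d → ℕ
level {suc d} zero    = suc d
level {suc d} (suc i) = level i

level≤ : ∀ {d} (i : Fin d) → level i ≤ d
level≤ zero    = ≤-refl
level≤ (suc i) = ≤-trans (level≤ i) (n≤1+n _)

var : ∀ {d} → Fin d → Var
var i = neighbour (level i)

implies : Fm → Fm → Fm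
implies φ ψ = neg (and φ (neg ψ))

∃-neighbour : ℕ → Fm → Fm
∃-neighbour k ψ = ex (neighbour k) (and (Eₐ (neighbour k) root) ψ)

⌜_⌝ : ∀ {d} → Formula d → Fm
⌜ edge i j ⌝  = Eₐ (var i) (var j)
⌜ less i j ⌝  = cmp ltC (var i) (var j)
⌜ equal i j ⌝ = cmp eqC (var i) (var j)
⌜ ¬ᶠ f ⌝      = neg ⌜ f ⌝
⌜ f ∧ᶠ g ⌝    = and ⌜ f ⌝ ⌜ g ⌝
⌜ f ∨ᶠ g ⌝    = neg (and (neg ⌜ f ⌝) (neg ⌜ g ⌝))
⌜ f ⇒ᶠ g ⌝    = implies ⌜ f ⌝ ⌜ g ⌝
⌜ f ⇔ᶠ g ⌝    = and (implies ⌜ f ⌝ ⌜ g ⌝) (implies ⌜ g ⌝ ⌜ f ⌝)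
⌜ ∃ᶠ {d} f ⌝  = ∃-neighbour (suc d) ⌜ f ⌝
⌜ ∀ᶠ {d} f ⌝  = neg (∃-neighbour (suc d) (neg ⌜ f ⌝))

cluster : ℕ → List Var
cluster zero    = root ∷ []
cluster (suc d) = neighbour (suc d) ∷ cluster d

neighbour∈cluster : ∀ {k d} → k ≤ d → neighbour k ∈ cluster d
neighbour∈cluster {d = zero}  z≤n = here refl
neighbour∈cluster {d = suc d} k≤1+d with m≤n⇒m<n∨m≡n k≤1+d
... | inj₁ (s≤s k≤d) = there (neighbour∈cluster k≤d)
... | inj₂ refl      = here refl

neighbour∉cluster : ∀ {k d} → d < k → neighbour k ∉ cluster d
neighbour∉cluster {d = zero}  d<k (here refl) = contradiction refl (<⇒≢ d<k)
neighbour∉cluster {d = suc d} d<k (here refl) = contradiction refl (<⇒≢ d<k)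
neighbour∉cluster {d = suc d} d<k (there k∈)  = neighbour∉cluster (≤-trans (n≤1+n _) d<k) k∈

var∈cluster : ∀ {d} (i : Fin d) → var i ∈ cluster d
var∈cluster zero    = here refl
var∈cluster (suc i) = there (var∈cluster i)

∃-neighbour-CFO : ∀ {d k ψ} → CFO (cluster (suc d)) k ψ → CFO (cluster d) (suc k) (∃-neighbour (suc d) ψ)
∃-neighbour-CFO = c-ex-nbr (neighbour∈cluster z≤n) (neighbour∉cluster ≤-refl) (λ _ → neighbour∈cluster ∘ s≤s⁻¹)

implies-CFO : ∀ {S k φ ψ} → CFO S k φ → CFO S k ψ → CFO S k (implies φ ψ)
implies-CFO φ-CFO ψ-CFO = c-neg (c-and φ-CFO (c-neg ψ-CFO))

⌜⌝-CFO : ∀ {d k} (f : Formula d) → depth f ≤ k → CFO (cluster d) k ⌜ f ⌝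
⌜⌝-CFO (edge i j)  _ = c-E (var∈cluster i) (var∈cluster j)
⌜⌝-CFO (less i j)  _ = c-cmp ltC (var∈cluster i) (var∈cluster j)
⌜⌝-CFO (equal i j) _ = c-cmp eqC (var∈cluster i) (var∈cluster j)
⌜⌝-CFO (¬ᶠ f)   f≤k = c-neg (⌜⌝-CFO f f≤k)
⌜⌝-CFO (f ∧ᶠ g) fg≤k = c-and (⌜⌝-CFO f (m⊔n≤o⇒m≤o _ _ fg≤k)) (⌜⌝-CFO g (m⊔n≤o⇒n≤o _ _ fg≤k))
⌜⌝-CFO (f ∨ᶠ g) fg≤k =
  c-neg (c-and (c-neg (⌜⌝-CFO f (m⊔n≤o⇒m≤o _ _ fg≤k))) (c-neg (⌜⌝-CFO g (m⊔n≤o⇒n≤o _ _ fg≤k))))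
⌜⌝-CFO (f ⇒ᶠ g) fg≤k = implies-CFO (⌜⌝-CFO f (m⊔n≤o⇒m≤o _ _ fg≤k)) (⌜⌝-CFO g (m⊔n≤o⇒n≤o _ _ fg≤k))
⌜⌝-CFO (f ⇔ᶠ g) fg≤k = c-and (implies-CFO f-CFO g-CFO) (implies-CFO g-CFO f-CFO)
  where
  f-CFO : CFO _ _ ⌜ f ⌝
  f-CFO = ⌜⌝-CFO f (m⊔n≤o⇒m≤o _ _ fg≤k)
  g-CFO : CFO _ _ ⌜ g ⌝
  g-CFO = ⌜⌝-CFO g (m⊔n≤o⇒n≤o _ _ fg≤k)
⌜⌝-CFO (∃ᶠ f) (s≤s f≤k) = ∃-neighbour-CFO (⌜⌝-CFO f f≤k)
⌜⌝-CFO (∀ᶠ f) (s≤s f≤k) = c-neg (∃-neighbour-CFO (c-neg (⌜⌝-CFO f f≤k)))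

update-same : ∀ {n} (ρ : Env n) x a → update ρ x a x ≡ just a
update-same ρ x a with x ≟V x
... | yes _  = refl
... | no x≢x = contradiction refl x≢x

update-other : ∀ {n} (ρ : Env n) {x y} a → y ≢ x → update ρ x a y ≡ ρ y
update-other ρ {x} {y} a y≢x with y ≟V x
... | yes y≡x = contradiction y≡x y≢x
... | no _    = refl

¬∃¬⇔∀ : ∀ {X : Set} {P : X → Set} → (∀ x → Dec (P x)) → (¬ ∃ λ x → ¬ P x) ⇔ (∀ x → P x)
¬∃¬⇔∀ P? = mk⇔ (λ ¬∃¬ x → decidable-stable (P? x) (λ ¬px → ¬∃¬ (x , ¬px))) (λ ∀P (x , ¬px) → ¬px (∀P x))

¬[¬×¬]⇔⊎ : ∀ {X Y : Set} → Dec X → Dec Y → (¬ (¬ X × ¬ Y)) ⇔ (X ⊎ Y)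
¬[¬×¬]⇔⊎ X? Y? =
  mk⇔ (λ ¬both → decidable-stable (X? ⊎-dec Y?) (λ ¬either → ¬both (¬either ∘ inj₁ , ¬either ∘ inj₂)))
      (λ { (inj₁ x) (¬x , _) → ¬x x ; (inj₂ y) (_ , ¬y) → ¬y y })

¬[×¬]⇔→ : ∀ {X Y : Set} → Dec Y → (¬ (X × ¬ Y)) ⇔ (X → Y)
¬[×¬]⇔→ Y? = mk⇔ (λ ¬counter x → decidable-stable Y? (λ ¬y → ¬counter (x , ¬y))) (λ x→y (x , ¬y) → ¬y (x→y x))

module Soundness (A : Str) {_<_ : Rel (Fin (size A)) 0ℓ} (_<?_ : Decidable₂ _<_)
                 {r : Fin (size A)} (r-top : ∀ a → E A a r ≡ true) where
  open Semantics A _<_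
  open Decide _<?_

  record Agrees {d} (ρ : Env (size A)) (γ : Fin d → Fin (size A)) : Set where
    constructor agrees
    field
      at-root : ρ root ≡ just r
      at-var  : ∀ i → ρ (var i) ≡ just (γ i)

  agrees-∷ : ∀ {d ρ} {γ : Fin d → Fin (size A)} → Agrees ρ γ → ∀ a →
             Agrees (update ρ (neighbour (suc d)) a) (a ∷ᵥ γ)
  agrees-∷ {d} {ρ} (agrees ρ-root ρ-var) a = agrees ρ-root extended
    where
    extended : ∀ i → update ρ (neighbour (suc d)) a (var i) ≡ just ((a ∷ᵥ _) i)
    extended zero    = update-same ρ _ a
    extended (suc i) = trans (update-other ρ {neighbour (suc d)} {var (suc i)} a
                               (λ eq → <⇒≢ (s≤s (level≤ i)) (cong proj₂ eq)))
                             (ρ-var i)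

  ∃-neighbour-sound : ∀ {d ρ} {γ : Fin d → Fin (size A)} ψ {P : Fin (size A) → Set} → Agrees ρ γ →
                      (∀ a → Sat A _<_ (update ρ (neighbour (suc d)) a) ψ ⇔ P a) →
                      Sat A _<_ ρ (∃-neighbour (suc d) ψ) ⇔ ∃ P
  ∃-neighbour-sound {d} {ρ} ψ (agrees ρ-root _) ψ⇔P =
    mk⇔ (λ (a , _ , s) → a , to (ψ⇔P a) s) (λ (a , pa) → a , guard a , from (ψ⇔P a) pa)
    where
    guard : ∀ a → Sat A _<_ (update ρ (neighbour (suc d)) a) (Eₐ (neighbour (suc d)) root)
    guard a rewrite update-same ρ (neighbour (suc d)) a | ρ-root = r-top a

  ⌜⌝-sound : ∀ {d} (f : Formula d) {ρ γ} → Agrees ρ γ → Sat A _<_ ρ ⌜ f ⌝ ⇔ ⟦ f ⟧ γ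
  implies-sound : ∀ {d} (f g : Formula d) {ρ γ} → Agrees ρ γ →
                  Sat A _<_ ρ (implies ⌜ f ⌝ ⌜ g ⌝) ⇔ (⟦ f ⟧ γ → ⟦ g ⟧ γ)

  implies-sound f g {γ = γ} ag =
    ⇔-trans (¬-cong-⇔ (⌜⌝-sound f ag ×-⇔ ¬-cong-⇔ (⌜⌝-sound g ag))) (¬[×¬]⇔→ (⟦ g ⟧? γ))

  ⌜⌝-sound (edge i j)  (agrees _ ρ-var) rewrite ρ-var i | ρ-var j = ⇔-refl
  ⌜⌝-sound (less i j)  (agrees _ ρ-var) rewrite ρ-var i | ρ-var j = ⇔-refl
  ⌜⌝-sound (equal i j) (agrees _ ρ-var) rewrite ρ-var i | ρ-var j = ⇔-refl
  ⌜⌝-sound (¬ᶠ f)   ag = ¬-cong-⇔ (⌜⌝-sound f ag)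
  ⌜⌝-sound (f ∧ᶠ g) ag = ⌜⌝-sound f ag ×-⇔ ⌜⌝-sound g ag
  ⌜⌝-sound (f ∨ᶠ g) {γ = γ} ag =
    ⇔-trans (¬-cong-⇔ (¬-cong-⇔ (⌜⌝-sound f ag) ×-⇔ ¬-cong-⇔ (⌜⌝-sound g ag)))
            (¬[¬×¬]⇔⊎ (⟦ f ⟧? γ) (⟦ g ⟧? γ))
  ⌜⌝-sound (f ⇒ᶠ g) ag = implies-sound f g ag
  ⌜⌝-sound (f ⇔ᶠ g) ag = ⇔-trans (implies-sound f g ag ×-⇔ implies-sound g f ag) implications⇔equivalence
  ⌜⌝-sound (∃ᶠ f) ag = ∃-neighbour-sound ⌜ f ⌝ ag (λ a → ⌜⌝-sound f (agrees-∷ ag a))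
  ⌜⌝-sound (∀ᶠ f) {γ = γ} ag =
    ⇔-trans (¬-cong-⇔ (∃-neighbour-sound (neg ⌜ f ⌝) ag (λ a → ¬-cong-⇔ (⌜⌝-sound f (agrees-∷ ag a)))))
            (¬∃¬⇔∀ (λ a → ⟦ f ⟧? (a ∷ᵥ γ)))

HasTop : Property
HasTop A = ∃ λ r → ∀ a → E A a r ≡ true

member : Var
member = 0 ∷ [] , 0

-- ∀ x_0^0 ∃ x_ε^1 (E(x_ε^1, x_ε^0) ∧ x_0^0 = x_ε^1): the root x_ε^0 is a top. CFO has no
-- unguarded quantifier inside a cluster, so x_0^0 ranges over the universe as a new cluster root.

isTop : Fm
isTop = neg (ex member (neg (∃-neighbour 1 (cmp eqC member (neighbour 1)))))

isTop-CFO : ∀ {k} → CFO (root ∷ []) (suc (suc k)) isTop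
isTop-CFO =
  c-neg (c-ex-child {w = []} {α = 0} (here refl) (λ { (here ()) ; (there ()) })
    (c-neg (c-ex-nbr {w = []} {i = 1} {j = 0} (there (here refl))
      (λ { (here ()) ; (there (here ())) ; (there (there ())) })
      (λ { zero _ → there (here refl) ; (suc _) (s≤s ()) })
      (c-cmpc {w = []} {α = 0} {i = 1} eqC (there (here refl)) (here refl)))))

isTop-sound : ∀ (A : Str) lt r → Sat A lt (update emptyEnv root r) isTop ⇔ (∀ a → E A a r ≡ true)
isTop-sound A lt r = mk⇔
  (λ ¬counter a → decidable-stable (E A a r Bool.≟ true)
                    (λ a⋢r → ¬counter (a , λ { (_ , a⊑r , refl) → a⋢r a⊑r })))
  (λ r-top (a , ¬witness) → ¬witness (a , r-top a , refl))

sentence : Formula 0 → Fm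
sentence θ = ex root (and isTop ⌜ θ ⌝)

sentence-CFO : (θ : Formula 0) → CFOSentence (sentence θ)
sentence-CFO θ = suc (suc (suc (depth θ))) , c-ex-root refl (c-and isTop-CFO (⌜⌝-CFO θ (m≤n+m _ 2)))

module _ (A : Str) {_<_ : Rel (Fin (size A)) 0ℓ} (_<?_ : Decidable₂ _<_) where
  open Semantics A _<_

  sentence-sound : (θ : Formula 0) → Sat A _<_ emptyEnv (sentence θ) ⇔ (HasTop A × ⟦ θ ⟧ (λ ()))
  sentence-sound θ = mk⇔
    (λ (r , top , s) → let r-top = to (isTop-sound A _<_ r) top in (r , r-top) , to (θ-sound r-top) s)
    (λ ((r , r-top) , t) → r , from (isTop-sound A _<_ r) r-top , from (θ-sound r-top) t)
    where
    θ-sound : ∀ {r} (r-top : ∀ a → E A a r ≡ true) → Sat A _<_ (update emptyEnv root r) ⌜ θ ⌝ ⇔ ⟦ θ ⟧ (λ ())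
    θ-sound r-top = Soundness.⌜⌝-sound A _<?_ r-top θ (Soundness.agrees refl (λ ()))

-- The property and its order-invariant CFO definition

module Atoms (A : Str) where

  _⊑_ : Rel (Fin (size A)) 0ℓ
  a ⊑ b = E A a b ≡ true

  _⊑?_ : Decidable₂ _⊑_
  a ⊑? b = E A a b Bool.≟ true

  IsAtom : Pred (Fin (size A)) 0ℓ
  IsAtom x = (∃ λ z → z ⊑ x × z ≢ x) × (∀ z → z ⊑ x → z ≡ x ⊎ (∀ w → z ⊑ w))

  IsAtom? : Decidable IsAtom
  IsAtom? x = any? (λ z → z ⊑? x ×-dec ¬? (z ≟ᶠ x))
              ×-dec all? (λ z → z ⊑? x →-dec (z ≟ᶠ x ⊎-dec all? (z ⊑?_)))

  open PointSets IsAtom? _⊑?_ public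

  atomCount : ℕ
  atomCount = count IsAtom?

EvenAtoms : Property
EvenAtoms A = HasTop A × Rich × atomCount ≢ 0 × parity atomCount ≡ 0ℙ
  where open Atoms A

atom : ∀ {d} → Fin d → Formula d
atom x = ∃ᶠ (edge (# 0) (suc x) ∧ᶠ ¬ᶠ equal (# 0) (suc x))
      ∧ᶠ ∀ᶠ (edge (# 0) (suc x) ⇒ᶠ equal (# 0) (suc x) ∨ᶠ ∀ᶠ (edge (# 1) (# 0)))

least greatest : ∀ {d} → Fin d → Formula d
least x    = ∀ᶠ (atom (# 0) ⇒ᶠ ¬ᶠ less (# 0) (suc x))
greatest x = ∀ᶠ (atom (# 0) ⇒ᶠ ¬ᶠ less (suc x) (# 0))

covers : ∀ {d} → Fin d → Fin d → Formula d
covers x y = less x y ∧ᶠ ∀ᶠ (atom (# 0) ⇒ᶠ ¬ᶠ (less (suc x) (# 0) ∧ᶠ less (# 0) (suc y)))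

rich : Formula 0
rich = ∃ᶠ (∀ᶠ (atom (# 0) ⇒ᶠ ¬ᶠ edge (# 0) (# 1)))
    ∧ᶠ ∀ᶠ (∀ᶠ (atom (# 0) ⇒ᶠ
             ∃ᶠ (∀ᶠ (atom (# 0) ⇒ᶠ edge (# 0) (# 1) ⇔ᶠ edge (# 0) (# 3) ∨ᶠ equal (# 0) (# 2)))))

alternates : ∀ {d} → Fin d → Formula d
alternates T = ∃ᶠ ((atom (# 0) ∧ᶠ least (# 0)) ∧ᶠ edge (# 0) (suc T))
            ∧ᶠ ∀ᶠ (∀ᶠ (atom (# 1) ⇒ᶠ atom (# 0) ⇒ᶠ covers (# 1) (# 0) ⇒ᶠ
                       edge (# 1) (suc (suc T)) ⇔ᶠ ¬ᶠ edge (# 0) (suc (suc T))))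
            ∧ᶠ ∃ᶠ ((atom (# 0) ∧ᶠ greatest (# 0)) ∧ᶠ ¬ᶠ edge (# 0) (suc T))

evenAtoms : Formula 0
evenAtoms = rich ∧ᶠ ∃ᶠ (alternates (# 0))

evenAtoms-defines : DefinesOrd (sentence evenAtoms) EvenAtoms
evenAtoms-defines A o =
  ⇔-trans (mk⇔ (map₂ λ (rich , even) → rich , from (alternates⇔even rich) even)
               (map₂ λ (rich , alt) → rich , to (alternates⇔even rich) alt))
          (⇔-sym (sentence-sound A (IsStrictTotalOrder._<?_ (isSTO o)) evenAtoms))
  where
  open Atoms A
  open Ordered (isSTO o)

definesOrd⇒orderInvariant : ∀ φ {P} → DefinesOrd φ P → OrderInvariant φ
definesOrd⇒orderInvariant φ defines A o₁ o₂ = ⇔-trans (⇔-sym (defines A o₁)) (defines A o₂)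

pullback : ∀ {m n} {f : Fin m → Fin n} → Injective _≡_ _≡_ f → LinOrd n → LinOrd m
pullback {f = f} f-injective o = record
  { _≺_   = λ a b → _≺_ o (f a) (f b)
  ; isSTO = OrderMonomorphism.isStrictTotalOrder f-monomorphism (isSTO o)
  }
  where
  f-monomorphism : IsOrderMonomorphism _≡_ _≡_ (λ a b → _≺_ o (f a) (f b)) (_≺_ o) f
  f-monomorphism = record
    { isOrderHomomorphism = record { cong = cong f ; mono = id }
    ; injective           = f-injective
    ; cancel              = id
    }

natural : ∀ n → LinOrd n
natural n = record { _≺_ = _<ᶠ_ ; isSTO = <-isStrictTotalOrder }

module _ {A B : Str} (A≅B : A ≅ B) where
  private
    f = proj₁ A≅B
    open Inverse f using () renaming (to to toB)

  lift2-≅ : ∀ {R : Rel (Fin (size A)) 0ℓ} {R′ : Rel (Fin (size B)) 0ℓ} →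
            (∀ a b → R a b ⇔ R′ (toB a) (toB b)) →
            ∀ {ρ : Env (size A)} {σ : Env (size B)} → (∀ x → σ x ≡ mapᵐ toB (ρ x)) →
            ∀ x y → lift2 R (ρ x) (ρ y) ⇔ lift2 R′ (σ x) (σ y)
  lift2-≅ R⇔R′ {ρ} σ≗ρ x y rewrite σ≗ρ x | σ≗ρ y with ρ x | ρ y
  ... | just a  | just b  = R⇔R′ a b
  ... | just _  | nothing = ⇔-refl
  ... | nothing | _       = ⇔-refl

  update-≅ : ∀ {ρ σ} → (∀ x → σ x ≡ mapᵐ toB (ρ x)) →
             ∀ x a y → update σ x (toB a) y ≡ mapᵐ toB (update ρ x a y)
  update-≅ σ≗ρ x a y with y ≟V x
  ... | yes _ = refl
  ... | no _  = σ≗ρ y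

  Sat-≅ : ∀ {_<_ : Rel (Fin (size B)) 0ℓ} ψ {ρ σ} → (∀ x → σ x ≡ mapᵐ toB (ρ x)) →
          Sat A (λ a b → toB a < toB b) ρ ψ ⇔ Sat B _<_ σ ψ
  Sat-≅ tt σ≗ρ = ⇔-refl
  Sat-≅ (Eₐ x y) {ρ} σ≗ρ =
    lift2-≅ (λ a b → mk⇔ (trans (sym (proj₂ A≅B a b))) (trans (proj₂ A≅B a b))) {ρ} σ≗ρ x y
  Sat-≅ (cmp eqC x y) {ρ} σ≗ρ = lift2-≅ (λ a b → mk⇔ (cong toB) (Injection.injective (↔⇒↣ f))) {ρ} σ≗ρ x y
  Sat-≅ {_<_} (cmp ltC x y) {ρ} σ≗ρ = lift2-≅ {R′ = cmpRel _<_ ltC} (λ _ _ → ⇔-refl) {ρ} σ≗ρ x y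
  Sat-≅ {_<_} (cmp gtC x y) {ρ} σ≗ρ = lift2-≅ {R′ = cmpRel _<_ gtC} (λ _ _ → ⇔-refl) {ρ} σ≗ρ x y
  Sat-≅ (neg ψ)   σ≗ρ = ¬-cong-⇔ (Sat-≅ ψ σ≗ρ)
  Sat-≅ (and ψ χ) σ≗ρ = Sat-≅ ψ σ≗ρ ×-⇔ Sat-≅ χ σ≗ρ
  Sat-≅ (ex x ψ)  σ≗ρ = Σ-⇔ (↔⇒↠ f) (λ {a} → Sat-≅ ψ (update-≅ σ≗ρ x a))

definesOrd⇒isoClosed : ∀ φ {P} → DefinesOrd φ P → IsoClosed P
definesOrd⇒isoClosed φ defines A B A≅B PA =
  from (defines B (natural (size B)))
    (to (Sat-≅ A≅B φ (λ _ → refl))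
      (to (defines A (pullback (Injection.injective (↔⇒↣ (proj₁ A≅B))) (natural (size B)))) PA))

-- Powerset algebras

T-does⇔ : ∀ {P : Set} (P? : Dec P) → T (does P?) ⇔ P
T-does⇔ (yes p) = mk⇔ (λ _ → p) _
T-does⇔ (no ¬p) = mk⇔ (λ ()) ¬p

T-cong : ∀ {a b} → a ≡ b → T a ⇔ T b
T-cong refl = ⇔-refl

pow2 : ℕ → ℕ
pow2 zero    = 1
pow2 (suc n) = pow2 n + pow2 n

Bits : ℕ → Set
Bits n = Fin n → Bool

consBit : ∀ {n} → Bool → Fin (pow2 n) → Fin (pow2 (suc n))
consBit {n} false i = i ↑ˡ pow2 n
consBit {n} true  i = pow2 n ↑ʳ i

decode : ∀ {n} → Fin (pow2 n) → Bits n
decode {zero}  _ = λ ()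
decode {suc n} i = [ (λ j → false ∷ᵥ decode j) , (λ j → true ∷ᵥ decode j) ] (splitAt (pow2 n) i)

encode : ∀ {n} → Bits n → Fin (pow2 n)
encode {zero}  s = zero
encode {suc n} s = consBit {n} (s zero) (encode (s ∘ suc))

decode-consBit : ∀ {n} b (i : Fin (pow2 n)) → decode {suc n} (consBit {n} b i) ≡ b ∷ᵥ decode {n} i
decode-consBit {n} false i rewrite splitAt-↑ˡ (pow2 n) i (pow2 n) = refl
decode-consBit {n} true  i rewrite splitAt-↑ʳ (pow2 n) (pow2 n) i = refl

decode-encode : ∀ {n} (s : Bits n) → decode {n} (encode s) ≗ s
decode-encode {suc n} s c rewrite decode-consBit {n} (s zero) (encode (s ∘ suc)) with c
... | zero  = refl
... | suc c = decode-encode (s ∘ suc) c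

encode-decode : ∀ {n} (i : Fin (pow2 n)) → encode (decode {n} i) ≡ i
encode-decode {zero}  zero = refl
encode-decode {suc n} i with splitAt (pow2 n) i in eq
... | inj₁ j = trans (cong (_↑ˡ pow2 n) (encode-decode {n} j)) (splitAt⁻¹-↑ˡ eq)
... | inj₂ j = trans (cong (pow2 n ↑ʳ_) (encode-decode {n} j)) (splitAt⁻¹-↑ʳ eq)

encode-cong : ∀ {n} {s t : Bits n} → s ≗ t → encode s ≡ encode t
encode-cong {zero}  s≗t = refl
encode-cong {suc n} s≗t = cong₂ (consBit {n}) (s≗t zero) (encode-cong (s≗t ∘ suc))

decode-injective : ∀ {n} {i j : Fin (pow2 n)} → decode {n} i ≗ decode j → i ≡ j
decode-injective {n} {i} {j} i≗j =
  trans (sym (encode-decode {n} i)) (trans (encode-cong i≗j) (encode-decode {n} j))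

_⊆_ : ∀ {n} → Bits n → Bits n → Set
s ⊆ t = ∀ c → T (s c) → T (t c)

_⊆?_ : ∀ {n} (s t : Bits n) → Dec (s ⊆ t)
s ⊆? t = all? λ c → T? (s c) →-dec T? (t c)

⊆-antisym : ∀ {n} {s t : Bits n} → s ⊆ t → t ⊆ s → s ≗ t
⊆-antisym {s = s} {t} s⊆t t⊆s c with s c | t c | s⊆t c | t⊆s c
... | false | false | _   | _   = refl
... | true  | true  | _   | _   = refl
... | false | true  | _   | t→s = ⊥-elim (t→s _)
... | true  | false | s→t | _   = ⊥-elim (s→t _)

_∪_ : ∀ {n} → Bits n → Bits n → Bits n
(s ∪ t) c = s c ∨ t c

⁅_⁆ : ∀ {n} → Fin n → Bits n
⁅ c ⁆ d = does (d ≟ᶠ c)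

∈⁅⁆⇔≡ : ∀ {n} {c d : Fin n} → T (⁅ c ⁆ d) ⇔ d ≡ c
∈⁅⁆⇔≡ = T-does⇔ (_ ≟ᶠ _)

-- Pow n is the powerset of Fin n ordered by inclusion, each subset encoded bitwise in Fin (2^n).

Pow : ℕ → Str
Pow n = record { size = pow2 n ; E = λ a b → does (decode {n} a ⊆? decode b) }

module _ {n : ℕ} where
  open Atoms (Pow n)

  ⊑⇔⊆ : ∀ {a b} → a ⊑ b ⇔ decode {n} a ⊆ decode b
  ⊑⇔⊆ {a} {b} = ⇔-trans (⇔-sym T-≡) (T-does⇔ (decode a ⊆? decode b))

  ⊑-refl : ∀ x → x ⊑ x
  ⊑-refl x = from ⊑⇔⊆ (λ _ → id)

  ∅ full : Bits n
  ∅    _ = false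
  full _ = true

  bottom : Fin (pow2 n)
  bottom = encode ∅

  bottom⊑ : ∀ y → bottom ⊑ y
  bottom⊑ y = from ⊑⇔⊆ (λ d bottom∋d → ⊥-elim (to (T-cong (decode-encode ∅ d)) bottom∋d))

  singleton : Fin n → Fin (pow2 n)
  singleton c = encode ⁅ c ⁆

  member-of-singleton : ∀ {x : Fin (pow2 n)} {c d} → decode {n} x ≗ ⁅ c ⁆ → T (decode x d) ⇔ d ≡ c
  member-of-singleton {d = d} x≗c = ⇔-trans (T-cong (x≗c d)) ∈⁅⁆⇔≡

  ⊑-singleton : ∀ {x y : Fin (pow2 n)} {c} → decode {n} x ≗ ⁅ c ⁆ → x ⊑ y ⇔ T (decode y c)
  ⊑-singleton {y = y} x≗c = ⇔-trans ⊑⇔⊆ (mk⇔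
    (λ x⊆y → x⊆y _ (from (member-of-singleton x≗c) refl))
    (λ y∋c d x∋d → subst (T ∘ decode y) (sym (to (member-of-singleton x≗c) x∋d)) y∋c))

  singleton⋢bottom : ∀ {x : Fin (pow2 n)} {c} → decode {n} x ≗ ⁅ c ⁆ → ¬ x ⊑ bottom
  singleton⋢bottom x≗c = to (T-cong (decode-encode ∅ _)) ∘ to (⊑-singleton x≗c)

  singleton⇒atom : ∀ {x : Fin (pow2 n)} {c} → decode {n} x ≗ ⁅ c ⁆ → IsAtom x
  singleton⇒atom {x} {c} x≗c = (bottom , bottom⊑ x , bottom≢x) , below
    where
    bottom≢x : bottom ≢ x
    bottom≢x bottom≡x = singleton⋢bottom x≗c (subst (x ⊑_) (sym bottom≡x) (⊑-refl x))
    below : ∀ z → z ⊑ x → z ≡ x ⊎ (∀ w → z ⊑ w)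
    below z z⊑x with T? (decode z c)
    ... | yes z∋c = inj₁ (decode-injective (⊆-antisym (to ⊑⇔⊆ z⊑x) (to ⊑⇔⊆ (from (⊑-singleton x≗c) z∋c))))
    ... | no  z∌c = inj₂ λ w → from ⊑⇔⊆ λ d z∋d →
      contradiction (subst (T ∘ decode z) (to (member-of-singleton x≗c) (to ⊑⇔⊆ z⊑x d z∋d)) z∋d) z∌c

  atom⇒singleton : ∀ {x : Fin (pow2 n)} → IsAtom x → ∃ λ c → decode {n} x ≗ ⁅ c ⁆
  atom⇒singleton {x} ((z , z⊑x , z≢x) , below) with any? (λ c → T? (decode x c) ×-dec ¬? (T? (decode z c)))
  ... | no ¬new = contradiction (decode-injective (⊆-antisym (to ⊑⇔⊆ z⊑x) x⊆z)) z≢x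
    where
    x⊆z : decode x ⊆ decode z
    x⊆z c x∋c = decidable-stable (T? _) (λ z∌c → ¬new (c , x∋c , z∌c))
  ... | yes (c , x∋c , _) with below (singleton c) (from (⊑-singleton (decode-encode ⁅ c ⁆)) x∋c)
  ...   | inj₁ c≡x   = c , λ d → trans (cong (λ e → decode e d) (sym c≡x)) (decode-encode ⁅ c ⁆ d)
  ...   | inj₂ c⊑all = contradiction (c⊑all bottom) (singleton⋢bottom (decode-encode ⁅ c ⁆))

  atom⇔singleton : ∀ {x} → IsAtom x ⇔ ∃ λ c → x ≡ singleton c
  atom⇔singleton = mk⇔
    (λ x-atom → let c , x≗c = atom⇒singleton x-atom
                in c , decode-injective (λ d → trans (x≗c d) (sym (decode-encode ⁅ c ⁆ d))))
    (λ { (c , refl) → singleton⇒atom (decode-encode ⁅ c ⁆) })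

  singleton-injective : Injective _≡_ _≡_ singleton
  singleton-injective {c} {d} c≡d = to (∈⁅⁆⇔≡ {c = d}) (to (T-cong d∋c) (from (∈⁅⁆⇔≡ {c = c}) refl))
    where
    d∋c : ⁅ c ⁆ c ≡ ⁅ d ⁆ c
    d∋c = trans (sym (decode-encode ⁅ c ⁆ c)) (trans (cong (λ e → decode e c) c≡d) (decode-encode ⁅ d ⁆ c))

  atomCount-Pow : atomCount ≡ n
  atomCount-Pow = trans (count-cong IsAtom? (λ x → any? (λ c → x ≟ᶠ singleton c)) (λ _ → atom⇔singleton))
                        (count-image singleton-injective)

  atom⊑atom⇔≡ : ∀ {p q} → IsAtom p → IsAtom q → p ⊑ q ⇔ p ≡ q
  atom⊑atom⇔≡ p-atom (_ , below) = mk⇔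
    (λ p⊑q → [ id , (λ p⊑all → contradiction (p⊑all bottom) (singleton⋢bottom (proj₂ (atom⇒singleton p-atom)))) ]
             (below _ p⊑q))
    (λ { refl → ⊑-refl _ })

  top-Pow : HasTop (Pow n)
  top-Pow = encode full , λ a → from ⊑⇔⊆ (λ d _ → from (T-cong (decode-encode full d)) _)

  rich-Pow : Rich
  rich-Pow = (bottom , λ q q-atom → singleton⋢bottom (proj₂ (atom⇒singleton q-atom))) , insert
    where
    insert : ∀ U p → IsAtom p → ∃ λ U′ → ∀ q → IsAtom q → (q ⊑ U′ ⇔ (q ⊑ U ⊎ q ≡ p))
    insert U p p-atom = U∪p , λ q q-atom →
      let c , q≗c = atom⇒singleton q-atom
      in begin
        q ⊑ U∪p                             ∼⟨ ⊑-singleton q≗c ⟩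
        T (decode U∪p c)                    ≡⟨ cong T (decode-encode (decode U ∪ decode p) c) ⟩
        T (decode U c ∨ decode p c)         ∼⟨ T-∨ ⟩
        (T (decode U c) ⊎ T (decode p c))   ∼⟨ ⇔-sym (⊑-singleton q≗c) ⊎-⇔ ⇔-sym (⊑-singleton q≗c) ⟩
        (q ⊑ U ⊎ q ⊑ p)                     ∼⟨ ⇔-refl ⊎-⇔ atom⊑atom⇔≡ q-atom p-atom ⟩
        (q ⊑ U ⊎ q ≡ p)                     ∎
      where
      open Related.EquationalReasoning
      U∪p : Fin (pow2 n)
      U∪p = encode (decode {n} U ∪ decode p)

evenAtoms-Pow : ∀ n → EvenAtoms (Pow n) ⇔ (n ≢ 0 × parity n ≡ 0ℙ)
evenAtoms-Pow n =
  mk⇔ (λ (_ , _ , even) → subst PositiveEven (atomCount-Pow {n}) even)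
      (λ even → top-Pow {n} , rich-Pow {n} , subst PositiveEven (sym (atomCount-Pow {n})) even)
  where
  open Atoms (Pow n)
  PositiveEven : ℕ → Set
  PositiveEven k = k ≢ 0 × parity k ≡ 0ℙ

-- Ehrenfeucht–Fraïssé games on powerset algebras

_≟ᵥ_ : ∀ {k} → DecidableEquality (Vec Bool k)
_≟ᵥ_ = ≡-decᵥ Bool._≟_

occurrences : ∀ {n k} → (Fin n → Vec Bool k) → Vec Bool k → ℕ
occurrences τ v = count (λ c → τ c ≟ᵥ v)

infix 4 _≈⟨_⟩_

_≈⟨_⟩_ : ℕ → ℕ → ℕ → Set
a ≈⟨ t ⟩ b = a ≡ b ⊎ (t ≤ a × t ≤ b)

record Similar {n m k} (q : ℕ) (τ : Fin n → Vec Bool k) (σ : Fin m → Vec Bool k) : Set where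
  constructor similar
  field
    occurrences≈ : ∀ v → occurrences τ v ≈⟨ pow2 q ⟩ occurrences σ v
open Similar

module _ {n m k : ℕ} {τ : Fin n → Vec Bool k} {σ : Fin m → Vec Bool k} where

  similar-sym : ∀ {q} → Similar q τ σ → Similar q σ τ
  similar-sym sim = similar λ v → ≈-sym (occurrences≈ sim v)
    where
    ≈-sym : ∀ {t a b} → a ≈⟨ t ⟩ b → b ≈⟨ t ⟩ a
    ≈-sym (inj₁ a≡b)         = inj₁ (sym a≡b)
    ≈-sym (inj₂ (t≤a , t≤b)) = inj₂ (t≤b , t≤a)

  similar-pred : ∀ {q} → Similar (suc q) τ σ → Similar q τ σ
  similar-pred {q} sim = similar λ v → ≈-weaken (occurrences≈ sim v)
    where
    ≈-weaken : ∀ {a b} → a ≈⟨ pow2 q + pow2 q ⟩ b → a ≈⟨ pow2 q ⟩ b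
    ≈-weaken (inj₁ a≡b)         = inj₁ a≡b
    ≈-weaken (inj₂ (t≤a , t≤b)) = inj₂ (≤-trans (m≤m+n _ _) t≤a , ≤-trans (m≤m+n _ _) t≤b)

  similar-zero : ∀ {q} → Similar q τ σ → Similar 0 τ σ
  similar-zero {zero}  sim = sim
  similar-zero {suc q} sim = similar-zero (similar-pred sim)

  similar-cong : ∀ {q} {σ′ : Fin m → Vec Bool k} → σ ≗ σ′ → Similar q τ σ → Similar q τ σ′
  similar-cong σ≗σ′ sim = similar λ v →
    subst (occurrences τ v ≈⟨ _ ⟩_)
          (count-cong (λ c → σ c ≟ᵥ v) (λ c → _ ≟ᵥ v) (λ c → mk⇔ (trans (sym (σ≗σ′ c))) (trans (σ≗σ′ c))))
          (occurrences≈ sim v)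

  similar-all : Similar 0 τ σ → (Q : Vec Bool k → Set) → (∀ c → Q (τ c)) → ∀ c → Q (σ c)
  similar-all sim Q all-τ c with count≢0⇒witness (λ c′ → τ c′ ≟ᵥ σ c) (occurs-in-τ (occurrences≈ sim (σ c)))
    where
    occurs-in-σ : occurrences σ (σ c) ≢ 0
    occurs-in-σ none = to (count≡0⇔none (λ c′ → σ c′ ≟ᵥ σ c)) none c refl
    occurs-in-τ : occurrences τ (σ c) ≈⟨ 1 ⟩ occurrences σ (σ c) → occurrences τ (σ c) ≢ 0
    occurs-in-τ (inj₁ eq)            = occurs-in-σ ∘ trans (sym eq)
    occurs-in-τ (inj₂ (1≤a , _)) a≡0 = contradiction (subst (1 ≤_) a≡0 1≤a) λ ()
  ... | c′ , τc′≡σc = subst Q τc′≡σc (all-τ c′)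

similar-⇔ : ∀ {n m k} {τ : Fin n → Vec Bool k} {σ : Fin m → Vec Bool k} → Similar 0 τ σ →
            (Q : Vec Bool k → Set) → (∀ c → Q (τ c)) ⇔ (∀ c → Q (σ c))
similar-⇔ sim Q = mk⇔ (similar-all sim Q) (similar-all (similar-sym sim) Q)

small-summand : ∀ {t x y b} → x ≤ t → t + t ≤ x + y → t + t ≤ b → t ≤ y × t ≤ b ∸ x × x + (b ∸ x) ≡ b
small-summand {t} {x} {y} x≤t t+t≤x+y t+t≤b =
  +-cancelˡ-≤ t t y (≤-trans t+t≤x+y (+-mono-≤ x≤t ≤-refl)) ,
  m+n≤o⇒m≤o∸n t (≤-trans (+-mono-≤ ≤-refl x≤t) t+t≤b) ,
  m+[n∸m]≡n (≤-trans x≤t (≤-trans (m≤m+n t t) t+t≤b))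

split : ∀ t {a b} a₁ a₂ → a ≈⟨ t + t ⟩ b → a₁ + a₂ ≡ a →
        ∃₂ λ b₁ b₂ → b₁ + b₂ ≡ b × a₁ ≈⟨ t ⟩ b₁ × a₂ ≈⟨ t ⟩ b₂
split t a₁ a₂ (inj₁ refl) refl = a₁ , a₂ , refl , inj₁ refl , inj₁ refl
split t {b = b} a₁ a₂ (inj₂ (t+t≤a , t+t≤b)) refl with a₁ ≤? t | a₂ ≤? t
... | yes a₁≤t | _ =
  let t≤a₂ , t≤b∸a₁ , sum = small-summand a₁≤t t+t≤a t+t≤b
  in a₁ , b ∸ a₁ , sum , inj₁ refl , inj₂ (t≤a₂ , t≤b∸a₁)
... | no _ | yes a₂≤t =
  let t≤a₁ , t≤b∸a₂ , sum = small-summand a₂≤t (subst (t + t ≤_) (+-comm a₁ a₂) t+t≤a) t+t≤b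
  in b ∸ a₂ , a₂ , trans (+-comm (b ∸ a₂) a₂) sum , inj₂ (t≤a₁ , t≤b∸a₂) , inj₁ refl
... | no a₁≰t | no a₂≰t =
  t , b ∸ t , m+[n∸m]≡n (≤-trans (m≤m+n t t) t+t≤b) ,
  inj₂ (<⇒≤ (≰⇒> a₁≰t) , ≤-refl) , inj₂ (<⇒≤ (≰⇒> a₂≰t) , m+n≤o⇒m≤o∸n t t+t≤b)

-- Points are selected greedily, as long as the demand for their value is not yet met.

select : ∀ {m} {X : Set} (_≟_ : DecidableEquality X) (τ : Fin m → X) (d : X → ℕ) →
         (∀ v → d v ≤ count (λ c → τ c ≟ v)) →
         ∃ λ (S : Fin m → Bool) → ∀ v → count (λ c → τ c ≟ v ×-dec S c Bool.≟ true) ≡ d v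
select {zero} _≟_ τ d d≤ = (λ ()) , λ v → sym (n≤0⇒n≡0 (d≤ v))
select {suc m} {X} _≟_ τ d d≤ with d (τ zero) in d₀
... | zero =
  let S , S-ok = select _≟_ (τ ∘ suc) d demand≤ in false ∷ᵥ S , counted S S-ok
  where
  demand≤ : ∀ v → d v ≤ count (λ c → τ (suc c) ≟ v)
  demand≤ v with τ zero ≟ v | d≤ v
  ... | yes refl | _   = subst (_≤ _) (sym d₀) z≤n
  ... | no _     | d≤v = d≤v
  counted : ∀ S → (∀ v → count (λ c → τ (suc c) ≟ v ×-dec S c Bool.≟ true) ≡ d v) →
            ∀ v → count (λ c → τ c ≟ v ×-dec (false ∷ᵥ S) c Bool.≟ true) ≡ d v
  counted S S-ok v with τ zero ≟ v
  ... | yes _ = S-ok v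
  ... | no _  = S-ok v
... | suc e =
  let S , S-ok = select _≟_ (τ ∘ suc) d′ demand≤ in true ∷ᵥ S , counted S S-ok
  where
  d′ : X → ℕ
  d′ v = if does (τ zero ≟ v) then e else d v
  demand≤ : ∀ v → d′ v ≤ count (λ c → τ (suc c) ≟ v)
  demand≤ v with τ zero ≟ v | d≤ v
  ... | yes refl | d≤v = s≤s⁻¹ (subst (_≤ _) d₀ d≤v)
  ... | no _     | d≤v = d≤v
  counted : ∀ S → (∀ v → count (λ c → τ (suc c) ≟ v ×-dec S c Bool.≟ true) ≡ d′ v) →
            ∀ v → count (λ c → τ c ≟ v ×-dec (true ∷ᵥ S) c Bool.≟ true) ≡ d v
  counted S S-ok v with τ zero ≟ v | S-ok v
  ... | yes refl | ok = trans (cong suc ok) (sym d₀)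
  ... | no _     | ok = ok

module _ {n k : ℕ} (S : Fin n → Bool) (τ : Fin n → Vec Bool k) (v : Vec Bool k) where

  occurrences-true : occurrences (λ c → S c ∷ τ c) (true ∷ v) ≡ count (λ c → τ c ≟ᵥ v ×-dec S c Bool.≟ true)
  occurrences-true =
    count-cong (λ c → (S c ∷ τ c) ≟ᵥ (true ∷ v)) (λ c → τ c ≟ᵥ v ×-dec S c Bool.≟ true) λ c →
      mk⇔ (λ eq → let head , tail = ∷-injective eq in tail , head) (λ (tail , head) → cong₂ _∷_ head tail)

  occurrences-false : occurrences (λ c → S c ∷ τ c) (false ∷ v) ≡ count (λ c → τ c ≟ᵥ v ×-dec ¬? (S c Bool.≟ true))
  occurrences-false =
    count-cong (λ c → (S c ∷ τ c) ≟ᵥ (false ∷ v)) (λ c → τ c ≟ᵥ v ×-dec ¬? (S c Bool.≟ true)) λ c →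
      mk⇔ (λ eq → let head , tail = ∷-injective eq in tail , Bool.not-¬ head)
          (λ (tail , ¬head) → cong₂ _∷_ (Bool.¬-not {y = true} ¬head) tail)

forth : ∀ {q n m k} {τ : Fin n → Vec Bool k} {σ : Fin m → Vec Bool k} → Similar (suc q) τ σ →
        (S : Fin n → Bool) → ∃ λ (R : Fin m → Bool) → Similar q (λ c → S c ∷ τ c) (λ c → R c ∷ σ c)
forth {q} {τ = τ} {σ} sim S = R , similar fits
  where
  inside outside : Vec Bool _ → ℕ
  inside  v = count (λ c → τ c ≟ᵥ v ×-dec S c Bool.≟ true)
  outside v = count (λ c → τ c ≟ᵥ v ×-dec ¬? (S c Bool.≟ true))

  parts : ∀ v → ∃₂ λ b₁ b₂ → b₁ + b₂ ≡ occurrences σ v × inside v ≈⟨ pow2 q ⟩ b₁ × outside v ≈⟨ pow2 q ⟩ b₂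
  parts v = split (pow2 q) (inside v) (outside v) (occurrences≈ sim v)
                  (count-partition (λ c → τ c ≟ᵥ v) (λ c → S c Bool.≟ true))

  b₁ b₂ : Vec Bool _ → ℕ
  b₁ v = proj₁ (parts v)
  b₂ v = proj₁ (proj₂ (parts v))

  b₁+b₂ : ∀ v → b₁ v + b₂ v ≡ occurrences σ v
  b₁+b₂ v = proj₁ (proj₂ (proj₂ (parts v)))

  selection : ∃ λ (R : Fin _ → Bool) → ∀ v → count (λ c → σ c ≟ᵥ v ×-dec R c Bool.≟ true) ≡ b₁ v
  selection = select _≟ᵥ_ σ b₁ (λ v → subst (b₁ v ≤_) (b₁+b₂ v) (m≤m+n (b₁ v) (b₂ v)))

  R : Fin _ → Bool
  R = proj₁ selection

  selected unselected : Vec Bool _ → ℕ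
  selected   v = count (λ c → σ c ≟ᵥ v ×-dec R c Bool.≟ true)
  unselected v = count (λ c → σ c ≟ᵥ v ×-dec ¬? (R c Bool.≟ true))

  selected≡b₁ : ∀ v → selected v ≡ b₁ v
  selected≡b₁ = proj₂ selection

  unselected≡b₂ : ∀ v → unselected v ≡ b₂ v
  unselected≡b₂ v = +-cancelˡ-≡ (b₁ v) _ _
    (trans (cong (_+ unselected v) (sym (selected≡b₁ v)))
           (trans (count-partition (λ c → σ c ≟ᵥ v) (λ c → R c Bool.≟ true)) (sym (b₁+b₂ v))))

  fits : ∀ v → occurrences (λ c → S c ∷ τ c) v ≈⟨ pow2 q ⟩ occurrences (λ c → R c ∷ σ c) v
  fits (true ∷ v)  = subst₂ _≈⟨ pow2 q ⟩_ (sym (occurrences-true S τ v))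
                       (sym (trans (occurrences-true R σ v) (selected≡b₁ v)))
                       (proj₁ (proj₂ (proj₂ (proj₂ (parts v)))))
  fits (false ∷ v) = subst₂ _≈⟨ pow2 q ⟩_ (sym (occurrences-false S τ v))
                       (sym (trans (occurrences-false R σ v) (unselected≡b₂ v)))
                       (proj₂ (proj₂ (proj₂ (proj₂ (parts v)))))

quantifierRank : Fm → ℕ
quantifierRank (neg ψ)   = quantifierRank ψ
quantifierRank (and ψ χ) = quantifierRank ψ ⊔ quantifierRank χ
quantifierRank (ex _ ψ)  = suc (quantifierRank ψ)
quantifierRank _         = 0

envOf : ∀ {N} (S : List Var) → Vec (Fin N) (length S) → Env N
envOf []      []       = emptyEnv
envOf (x ∷ S) (a ∷ as) = update (envOf S as) x a

envOf-position : ∀ {x S} → x ∈ S → ∃ λ i → ∀ {N} (as : Vec (Fin N) (length S)) → envOf S as x ≡ just (lookup as i)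
envOf-position {x} {y ∷ S} x∈ with x ≟V y
... | yes refl = zero , λ { (a ∷ as) → update-same (envOf S as) x a }
... | no x≢y   = let i , at-i = envOf-position (Any.tail x≢y x∈)
                 in suc i , λ { (a ∷ as) → trans (update-other (envOf S as) a x≢y) (at-i as) }

profile : ∀ {n k} → Vec (Fin (pow2 n)) k → Fin n → Vec Bool k
profile as c = map (λ a → decode a c) as

module _ (n : ℕ) {k : ℕ} (as : Vec (Fin (pow2 n)) k) (i j : Fin k) where
  private
    lookup-profile : ∀ (c : Fin n) l → lookup (profile as c) l ≡ decode (lookup as l) c
    lookup-profile c l = lookup-map l (λ a → decode a c) as

  edge-profile : E (Pow n) (lookup as i) (lookup as j) ≡ true ⇔
                 (∀ (c : Fin n) → T (lookup (profile as c) i) → T (lookup (profile as c) j))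
  edge-profile = ⇔-trans (⊑⇔⊆ {n}) (mk⇔
    (λ i⊆j c → from (T-cong (lookup-profile c j)) ∘ i⊆j c ∘ to (T-cong (lookup-profile c i)))
    (λ i⊆j c → to (T-cong (lookup-profile c j)) ∘ i⊆j c ∘ from (T-cong (lookup-profile c i))))

  equal-profile : lookup as i ≡ lookup as j ⇔ (∀ (c : Fin n) → lookup (profile as c) i ≡ lookup (profile as c) j)
  equal-profile = mk⇔
    (λ eq c → trans (lookup-profile c i) (trans (cong (λ a → decode a c) eq) (sym (lookup-profile c j))))
    (λ eq → decode-injective λ c → trans (sym (lookup-profile c i)) (trans (eq c) (lookup-profile c j)))

Sat-similar : ∀ {q} n m {S ψ} → FO S ψ → quantifierRank ψ ≤ q →
              (as : Vec (Fin (pow2 n)) (length S)) (bs : Vec (Fin (pow2 m)) (length S)) →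
              Similar q (profile {n} as) (profile {m} bs) →
              Sat (Pow n) (λ _ _ → ⊥) (envOf S as) ψ ⇔ Sat (Pow m) (λ _ _ → ⊥) (envOf S bs) ψ

∃-similar : ∀ {q} n m {x S ψ} → FO (x ∷ S) ψ → quantifierRank ψ ≤ q →
            (as : Vec (Fin (pow2 n)) (length S)) (bs : Vec (Fin (pow2 m)) (length S)) →
            Similar (suc q) (profile {n} as) (profile {m} bs) →
            Sat (Pow n) (λ _ _ → ⊥) (envOf S as) (ex x ψ) → Sat (Pow m) (λ _ _ → ⊥) (envOf S bs) (ex x ψ)

Sat-similar n m fo-tt _ _ _ _ = ⇔-refl
Sat-similar n m (fo-E x∈ y∈) _ as bs sim with envOf-position x∈ | envOf-position y∈
... | i , x-at | j , y-at rewrite x-at as | y-at as | x-at bs | y-at bs =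
  ⇔-trans (edge-profile n as i j)
    (⇔-trans (similar-⇔ (similar-zero sim) (λ v → T (lookup v i) → T (lookup v j)))
             (⇔-sym (edge-profile m bs i j)))
Sat-similar n m (fo-eq x∈ y∈) _ as bs sim with envOf-position x∈ | envOf-position y∈
... | i , x-at | j , y-at rewrite x-at as | y-at as | x-at bs | y-at bs =
  ⇔-trans (equal-profile n as i j)
    (⇔-trans (similar-⇔ (similar-zero sim) (λ v → lookup v i ≡ lookup v j))
             (⇔-sym (equal-profile m bs i j)))
Sat-similar n m (fo-neg ψ-FO) ψ≤q as bs sim = ¬-cong-⇔ (Sat-similar n m ψ-FO ψ≤q as bs sim)
Sat-similar n m (fo-and ψ-FO χ-FO) ψχ≤q as bs sim =
  Sat-similar n m ψ-FO (m⊔n≤o⇒m≤o _ _ ψχ≤q) as bs sim ×-⇔ Sat-similar n m χ-FO (m⊔n≤o⇒n≤o _ _ ψχ≤q) as bs sim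
Sat-similar n m (fo-ex ψ-FO) (s≤s ψ≤q) as bs sim =
  mk⇔ (∃-similar n m ψ-FO ψ≤q as bs sim) (∃-similar m n ψ-FO ψ≤q bs as (similar-sym sim))

∃-similar n m ψ-FO ψ≤q as bs sim (a , a-sat) =
  let R , sim′ = forth sim (decode a)
  in encode R , to (Sat-similar n m ψ-FO ψ≤q (a ∷ as) (encode R ∷ bs)
                      (similar-cong (λ c → cong (_∷ profile bs c) (sym (decode-encode R c))) sim′)) a-sat

Pow-FO-equivalent : ∀ {ψ} n m → FOSentence ψ → n ≈⟨ pow2 (quantifierRank ψ) ⟩ m → Pow n ⊨ ψ ⇔ Pow m ⊨ ψ
Pow-FO-equivalent n m ψ-FO n≈m = Sat-similar n m ψ-FO ≤-refl [] [] (similar empty-profiles)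
  where
  empty-profiles : ∀ v → occurrences (profile {n} []) v ≈⟨ _ ⟩ occurrences (profile {m} []) v
  empty-profiles [] = subst₂ _≈⟨ _ ⟩_ (sym (count-all (λ c → profile {n} [] c ≟ᵥ []) λ _ → refl))
                                      (sym (count-all (λ c → profile {m} [] c ≟ᵥ []) λ _ → refl)) n≈m

pow2≢0 : ∀ q → pow2 q ≢ 0
pow2≢0 (suc q) eq = pow2≢0 q (m+n≡0⇒m≡0 (pow2 q) eq)

evenAtoms-not-FO : ¬ ∃ λ ψ → FOSentence ψ × Defines ψ EvenAtoms
evenAtoms-not-FO (ψ , ψ-FO , ψ-defines) = odd (begin
  EvenAtoms (Pow (t + t))             ∼⟨ ψ-defines (Pow (t + t)) ⟩
  Pow (t + t) ⊨ ψ                     ∼⟨ Pow-FO-equivalent (t + t) (suc (t + t)) ψ-FO large ⟩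
  Pow (suc (t + t)) ⊨ ψ               ∼⟨ ⇔-sym (ψ-defines (Pow (suc (t + t)))) ⟩
  EvenAtoms (Pow (suc (t + t)))       ∎)
  where
  open Related.EquationalReasoning
  t : ℕ
  t = pow2 (quantifierRank ψ)
  even : parity (t + t) ≡ 0ℙ
  even = trans (+-homo-+ t t) (p+p≡0ℙ (parity t))
  large : t + t ≈⟨ t ⟩ suc (t + t)
  large = inj₂ (m≤m+n t t , ≤-trans (m≤m+n t t) (n≤1+n _))
  even-Pow : EvenAtoms (Pow (t + t))
  even-Pow = from (evenAtoms-Pow (t + t)) (pow2≢0 (suc (quantifierRank ψ)) , even)
  odd : ¬ (EvenAtoms (Pow (t + t)) ⇔ EvenAtoms (Pow (suc (t + t))))
  odd same = to (even-suc⇔odd (t + t)) (proj₂ (to (evenAtoms-Pow (suc (t + t))) (to same even-Pow))) even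

mainTheorem3 : Σ Property λ P →
                 IsoClosed P
                 × Σ Fm (λ φ → CFOSentence φ × OrderInvariant φ × DefinesOrd φ P)
                 × ¬ Σ Fm (λ ψ → FOSentence ψ × Defines ψ P)
mainTheorem3 =
  EvenAtoms ,
  definesOrd⇒isoClosed φ evenAtoms-defines ,
  (φ , sentence-CFO evenAtoms , definesOrd⇒orderInvariant φ evenAtoms-defines , evenAtoms-defines) ,
  evenAtoms-not-FO
  where
  φ : Fm
  φ = sentence evenAtoms
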